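{- Let $\mathrm{sort}$ be a sort function satisfying the extended characteristic property. Let $T$ be a type with decidable equality and $\leq$ a total order on $T$. Then for all $s_1, s_2 : \mathrm{list}\,T$, $\mathrm{sort}_\leq\,s_1 = \mathrm{sort}_\leq\,s_2$ if and only if $s_1$ is a permutation of $s_2$.
   Context: A total order is a relation that is transitive, antisymmetric ($x\leq y \wedge y \leq x \Rightarrow x = y$) and total. A list $s_1$ is a permutation of $s_2$ if every element occurs the same number of times in both. Lists: $[]$ empty, $x :: s$ cons, $[x]$ singleton, $\mathbin{+\!\!+}$ concatenation, $\mathrm{rev}$ list reversal. A "relation" $\leq$ on a type $T$ is a function $T \to T \to \mathrm{bool}$. Merge: $[] \mathbin{\land\hspace{ -.45em}\land}_\leq ys = ys$, $xs \mathbin{\land\hspace{ -.45em}\land}_\leq [] = xs$, $(x :: xs) \mathbin{\land\hspace{ -.45em}\land}_\leq (y :: ys) = x :: (xs \mathbin{\land\hspace{ -.45em}\land}_\leq (y :: ys))$ if $x \leq y$, else $y :: ((x :: xs) \mathbin{\land\hspace{ -.45em}\land}_\leq ys)$. Define $xs \mathbin{\lor\hspace{ -.45em}\lor}_\leq ys := \mathrm{rev}\,(\mathrm{rev}\,ys \mathbin{\land\hspace{ -.45em}\land}_\geq \mathrm{rev}\,xs)$ where $\geq$ is the converse of $\leq$. A sort function assigns to every type $T$ and relation $\leq$ on $T$ a function $\mathrm{sort}_\leq : \mathrm{list}\,T \to \mathrm{list}\,T$. It satisfies the extended characteristic property if there is a polymorphic $\mathrm{asort}$ of type $\forall (T\,R:\mathcal{U}),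 (T\to T\to\mathrm{bool}) \to (R\to R\to R)\to(R\to R\to R)\to(T\to R)\to R\to\mathrm{list}\,T\to R$ such that (1) $\mathrm{asort}\,(\leq)\,(\mathbin{\land\hspace{ -.45em}\land}_\leq)\,(\mathbin{\lor\hspace{ -.45em}\lor}_\leq)\,(\lambda x.[x])\,[]\,xs = \mathrm{sort}_\leq\,xs$ for all $T,\leq,xs$; (2) $\mathrm{asort}\,(\leq)\,(\mathbin{+\!\!+})\,(\mathbin{+\!\!+})\,(\lambda x.[x])\,[]\,xs = xs$ for all $T,\leq,xs$; (3) $\mathrm{asort}$ is relationally parametric: for all types $T_1,T_2$, relation $\sim_T\subseteq T_1\times T_2$, types $R_1,R_2$, relation $\sim_R\subseteq R_1\times R_2$, all $\leq_i : T_i\to T_i\to\mathrm{bool}$ with $x_1\sim_T x_2\wedge y_1\sim_T y_2 \Rightarrow (x_1\leq_1 y_1)=(x_2\leq_2 y_2)$, all $m_i, m'_i : R_i\to R_i\to R_i$ each pair preserving $\sim_R$ (i.e. $a_1\sim_R a_2\wedge b_1\sim_R b_2\Rightarrow m_1 a_1 b_1 \sim_R m_2 a_2 b_2$, and likewise for $m'$), all $s_i:T_i\to R_i$ with $x_1\sim_T x_2\Rightarrow s_1x_1\sim_R s_2x_2$, all $e_i : R_i$ with $e_1\sim_R e_2$, and all equal-length pointwise $\sim_T$-related lists $xs_1, xs_2$: $\mathrm{asort}\,(\leq_1)\,m_1\,m'_1\,s_1\,e_1\,xs_1 \sim_R \mathrm{asort}\,(\leq_2)\,m_2\,m'_2\,s_2\,e_2\,xs_2$.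 -}

module Defs where

open import Data.Bool using (Bool; true; false; if_then_else_)
open import Data.List using (List; []; _∷_; [_]; _++_; reverse)
open import Data.List.Relation.Binary.Pointwise using (Pointwise)
open import Data.Nat using (ℕ; suc)
open import Data.Product using (Σ; _×_)
open import Data.Sum using (_⊎_)
open import Relation.Binary.PropositionalEquality using (_≡_)
open import Relation.Binary.Definitions using (DecidableEquality)
open import Relation.Nullary using (yes; no)

merge : {T : Set} → (T → T → Bool) → List T → List T → List T
merge le [] ys = ys
merge le (x ∷ xs) [] = x ∷ xs
merge le (x ∷ xs) (y ∷ ys) =
  if le x y then x ∷ merge le xs (y ∷ ys) else y ∷ merge le (x ∷ xs) ys

converse : {T : Set} → (T → T → Bool) → (T → T → Bool)
converse le x y = le y x

revmerge : {T : Set} → (T → T → Bool) → List T → List T → List T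
revmerge le xs ys = reverse (merge (converse le) (reverse ys) (reverse xs))

SortFun : Set₁
SortFun = (T : Set) → (T → T → Bool) → List T → List T

ASortType : Set₁
ASortType = (T R : Set) → (T → T → Bool) → (R → R → R) → (R → R → R)
          → (T → R) → R → List T → R

Parametric : ASortType → Set₁
Parametric asort =
  (T₁ T₂ : Set) (relT : T₁ → T₂ → Set) (R₁ R₂ : Set) (relR : R₁ → R₂ → Set)
  (le₁ : T₁ → T₁ → Bool) (le₂ : T₂ → T₂ → Bool) →
  (∀ {x₁ x₂ y₁ y₂} → relT x₁ x₂ → relT y₁ y₂ → le₁ x₁ y₁ ≡ le₂ x₂ y₂) →
  (m₁ : R₁ → R₁ → R₁) (m₂ : R₂ → R₂ → R₂) →
  (∀ {a₁ a₂ b₁ b₂} → relR a₁ a₂ → relR b₁ b₂ → relR (m₁ a₁ b₁) (m₂ a₂ b₂)) →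
  (m₁' : R₁ → R₁ → R₁) (m₂' : R₂ → R₂ → R₂) →
  (∀ {a₁ a₂ b₁ b₂} → relR a₁ a₂ → relR b₁ b₂ → relR (m₁' a₁ b₁) (m₂' a₂ b₂)) →
  (s₁ : T₁ → R₁) (s₂ : T₂ → R₂) →
  (∀ {x₁ x₂} → relT x₁ x₂ → relR (s₁ x₁) (s₂ x₂)) →
  (e₁ : R₁) (e₂ : R₂) → relR e₁ e₂ →
  (xs₁ : List T₁) (xs₂ : List T₂) → Pointwise relT xs₁ xs₂ →
  relR (asort T₁ R₁ le₁ m₁ m₁' s₁ e₁ xs₁) (asort T₂ R₂ le₂ m₂ m₂' s₂ e₂ xs₂)

ExtendedCharacteristic : SortFun → Set₁
ExtendedCharacteristic sort =
  Σ ASortType λ asort →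
    ((T : Set) (le : T → T → Bool) (xs : List T) →
       asort T (List T) le (merge le) (revmerge le) [_] [] xs ≡ sort T le xs)
  × ((T : Set) (le : T → T → Bool) (xs : List T) →
       asort T (List T) le _++_ _++_ [_] [] xs ≡ xs)
  × Parametric asort

record TotalOrder {T : Set} (le : T → T → Bool) : Set where
  field
    trans   : ∀ x y z → le x y ≡ true → le y z ≡ true → le x z ≡ true
    antisym : ∀ x y → le x y ≡ true → le y x ≡ true → x ≡ y
    total   : ∀ x y → (le x y ≡ true) ⊎ (le y x ≡ true)

count : {T : Set} → DecidableEquality T → T → List T → ℕ
count eq x [] = 0
count eq x (y ∷ s) with eq x y
... | yes _ = suc (count eq x s)
... | no _ = count eq x s

Perm : {T : Set} → DecidableEquality T → List T → List T → Set
Perm eq s₁ s₂ = ∀ x → count eq x s₁ ≡ count eq x s₂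

-- Parametricity of asort at the relation _↭_ compares its merging instance, which is sort, with
-- its concatenating instance, which is the identity: merge and revmerge permute _++_, so
-- sort s ↭ s.  Parametricity at the unary predicate "sorted" shows that sort s is sorted, since
-- merge and revmerge preserve sortedness.  Sorted permutations of one another are equal, and
-- being a permutation is the same as having equal occurrence counts.
module Submission where

open import Defs
open import Algebra.Properties.CommutativeSemigroup using (x∙yz≈y∙xz)
open import Data.Bool using (Bool; true; T; if_then_else_)
open import Data.Bool.Properties using (T-≡)
open import Data.Empty using (⊥-elim)
open import Data.List.Base as List using (List; []; _∷_; [_]; _++_; reverse)
open import Data.List.Membership.Propositional using (_∈_)
open import Data.List.Membership.Propositional.Properties using (∈-∃++)
open import Data.List.Properties using (unfold-reverse)
open import Data.List.Relation.Binary.Permutation.Propositional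
  using (_↭_; refl; prep; swap; trans; ↭-refl; ↭-sym; ↭-trans; ↭⇒↭ₛ; module PermutationReasoning)
open import Data.List.Relation.Binary.Permutation.Propositional.Properties
  using (merge-↭; ↭-reverse; ++⁺; ++-comm; shift; All-resp-↭)
open import Data.List.Relation.Binary.Pointwise using (Pointwise-≡⇒≡)
import Data.List.Relation.Binary.Pointwise.Properties as Pointwise
import Data.List.Relation.Unary.All as All
open import Data.List.Relation.Unary.AllPairs using (AllPairs; []; _∷_)
import Data.List.Relation.Unary.AllPairs.Properties as AllPairs
open import Data.List.Relation.Unary.Any using (here; there)
open import Data.List.Relation.Unary.Linked using ([]; [-])
open import Data.List.Relation.Unary.Sorted.TotalOrder using (Sorted)
open import Data.List.Relation.Unary.Sorted.TotalOrder.Properties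
  using (AllPairs⇒Sorted; Sorted⇒AllPairs; merge⁺; ↗↭↗⇒≋)
open import Data.Nat using (suc; _+_)
open import Data.Nat.Properties using (+-cancelˡ-≡; +-commutativeSemigroup)
open import Data.Product using (_×_; _,_)
open import Data.Sum using ([_,_]′)
import Data.Sum as Sum
open import Data.Unit using (⊤; tt)
open import Function using (flip; id)
open import Function.Bundles using (Equivalence)
open import Level using (0ℓ)
open import Relation.Binary.Bundles using (DecTotalOrder)
import Relation.Binary.Bundles as Bundles
open import Relation.Binary.Definitions using (DecidableEquality)
open import Relation.Binary.PropositionalEquality as ≡
  using (_≡_; refl; cong; cong₂; subst; subst₂; module ≡-Reasoning)
open import Relation.Nullary using (yes; no)
open import Relation.Nullary.Decidable using (T?)

module _ {A : Set} (eq : DecidableEquality A) where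

  count-∷ : ∀ z x xs → count eq z (x ∷ xs) ≡ count eq z [ x ] + count eq z xs
  count-∷ z x xs with eq z x
  ... | yes _ = refl
  ... | no _ = refl

  count-head : ∀ x xs → count eq x (x ∷ xs) ≡ suc (count eq x xs)
  count-head x xs with eq x x
  ... | yes _ = refl
  ... | no x≢x = ⊥-elim (x≢x refl)

  count≡suc⇒∈ : ∀ {x n} ys → count eq x ys ≡ suc n → x ∈ ys
  count≡suc⇒∈ {x} (y ∷ ys) c with eq x y
  ... | yes x≡y = here x≡y
  ... | no _ = there (count≡suc⇒∈ ys c)

  Perm-∷⁺ : ∀ x {xs ys} → Perm eq xs ys → Perm eq (x ∷ xs) (x ∷ ys)
  Perm-∷⁺ x {xs} {ys} p z = begin
    count eq z (x ∷ xs)               ≡⟨ count-∷ z x xs ⟩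
    count eq z [ x ] + count eq z xs  ≡⟨ cong (count eq z [ x ] +_) (p z) ⟩
    count eq z [ x ] + count eq z ys  ≡⟨ count-∷ z x ys ⟨
    count eq z (x ∷ ys)               ∎
    where open ≡-Reasoning

  Perm-∷⁻ : ∀ x {xs ys} → Perm eq (x ∷ xs) (x ∷ ys) → Perm eq xs ys
  Perm-∷⁻ x {xs} {ys} p z = +-cancelˡ-≡ (count eq z [ x ]) _ _
    (≡.trans (≡.sym (count-∷ z x xs)) (≡.trans (p z) (count-∷ z x ys)))

  Perm-swap : ∀ x y xs → Perm eq (x ∷ y ∷ xs) (y ∷ x ∷ xs)
  Perm-swap x y xs z = begin
    count eq z (x ∷ y ∷ xs)                                ≡⟨ count-∷ z x _ ⟩
    count eq z [ x ] + count eq z (y ∷ xs)                 ≡⟨ cong (count eq z [ x ] +_) (count-∷ z y xs) ⟩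
    count eq z [ x ] + (count eq z [ y ] + count eq z xs)  ≡⟨ x∙yz≈y∙xz +-commutativeSemigroup
                                                                (count eq z [ x ]) (count eq z [ y ]) (count eq z xs) ⟩
    count eq z [ y ] + (count eq z [ x ] + count eq z xs)  ≡⟨ cong (count eq z [ y ] +_) (count-∷ z x xs) ⟨
    count eq z [ y ] + count eq z (x ∷ xs)                 ≡⟨ count-∷ z y _ ⟨
    count eq z (y ∷ x ∷ xs)                                ∎
    where open ≡-Reasoning

  ↭⇒Perm : ∀ {xs ys} → xs ↭ ys → Perm eq xs ys
  ↭⇒Perm refl z = refl
  ↭⇒Perm (prep x p) = Perm-∷⁺ x (↭⇒Perm p)
  ↭⇒Perm (swap x y p) z = ≡.trans (Perm-swap x y _ z) (Perm-∷⁺ y (Perm-∷⁺ x (↭⇒Perm p)) z)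
  ↭⇒Perm (trans p q) z = ≡.trans (↭⇒Perm p z) (↭⇒Perm q z)

  Perm⇒↭ : ∀ xs ys → Perm eq xs ys → xs ↭ ys
  Perm⇒↭ [] [] p = refl
  Perm⇒↭ [] (y ∷ ys) p with ≡.trans (p y) (count-head y ys)
  ... | ()
  Perm⇒↭ (x ∷ xs) ys p with ∈-∃++ (count≡suc⇒∈ ys (≡.trans (≡.sym (p x)) (count-head x xs)))
  ... | us , vs , refl = ↭-trans (prep x (Perm⇒↭ xs (us ++ vs) xs≈us++vs)) (↭-sym x∷us++vs)
    where
    x∷us++vs : us ++ [ x ] ++ vs ↭ x ∷ us ++ vs
    x∷us++vs = shift x us vs

    xs≈us++vs : Perm eq xs (us ++ vs)
    xs≈us++vs = Perm-∷⁻ x (λ z → ≡.trans (p z) (↭⇒Perm x∷us++vs z))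

merge≡List-merge : {A : Set} (le : A → A → Bool) →
  ∀ xs ys → merge le xs ys ≡ List.merge (λ x y → T? (le x y)) xs ys
merge≡List-merge le [] ys = refl
merge≡List-merge le (x ∷ xs) [] = refl
merge≡List-merge le (x ∷ xs) (y ∷ ys) =
  cong₂ (λ u v → if le x y then x ∷ u else y ∷ v)
    (merge≡List-merge le xs (y ∷ ys)) (merge≡List-merge le (x ∷ xs) ys)

merge-↭-++ : {A : Set} (le : A → A → Bool) → ∀ xs ys → merge le xs ys ↭ xs ++ ys
merge-↭-++ le xs ys =
  subst (_↭ xs ++ ys) (≡.sym (merge≡List-merge le xs ys)) (merge-↭ _ xs ys)

revmerge-↭-++ : {A : Set} (le : A → A → Bool) → ∀ xs ys → revmerge le xs ys ↭ xs ++ ys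
revmerge-↭-++ le xs ys = begin
  reverse (merge (converse le) (reverse ys) (reverse xs))  ↭⟨ ↭-reverse _ ⟩
  merge (converse le) (reverse ys) (reverse xs)            ↭⟨ merge-↭-++ (converse le) (reverse ys) (reverse xs) ⟩
  reverse ys ++ reverse xs                                 ↭⟨ ++⁺ (↭-reverse ys) (↭-reverse xs) ⟩
  ys ++ xs                                                 ↭⟨ ++-comm ys xs ⟩
  xs ++ ys                                                 ∎
  where open PermutationReasoning

AllPairs-reverse : {A : Set} {R : A → A → Set} {xs : List A} →
  AllPairs R xs → AllPairs (flip R) (reverse xs)
AllPairs-reverse {xs = []} [] = []
AllPairs-reverse {R = R} {x ∷ xs} (Rx ∷ Rxs) =
  subst (AllPairs (flip R)) (≡.sym (unfold-reverse x xs))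
    (AllPairs.++⁺ (AllPairs-reverse Rxs) (All.[] ∷ [])
      (All.map (All._∷ All.[]) (All-resp-↭ (↭-sym (↭-reverse xs)) Rx)))

converse-TotalOrder : {A : Set} {le : A → A → Bool} → TotalOrder le → TotalOrder (converse le)
converse-TotalOrder order = record
  { trans = λ x y z p q → TotalOrder.trans order z y x q p
  ; antisym = λ x y p q → TotalOrder.antisym order x y q p
  ; total = λ x y → TotalOrder.total order y x
  }

module _ {A : Set} (eq : DecidableEquality A) {le : A → A → Bool} (order : TotalOrder le) where
  open TotalOrder order renaming (trans to le-trans)

  private
    T⇒≡ : ∀ {b} → T b → b ≡ true
    T⇒≡ = Equivalence.to T-≡

    ≡⇒T : ∀ {b} → b ≡ true → T b
    ≡⇒T = Equivalence.from T-≡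

  ≤-decTotalOrder : DecTotalOrder 0ℓ 0ℓ 0ℓ
  ≤-decTotalOrder = record
    { Carrier = A
    ; _≈_ = _≡_
    ; _≤_ = λ x y → T (le x y)
    ; isDecTotalOrder = record
      { isTotalOrder = record
        { isPartialOrder = record
          { isPreorder = record
            { isEquivalence = ≡.isEquivalence
            ; reflexive = λ { {x} refl → ≡⇒T ([ id , id ]′ (total x x)) }
            ; trans = λ {x} {y} {z} p q → ≡⇒T (le-trans x y z (T⇒≡ p) (T⇒≡ q))
            }
          ; antisym = λ {x} {y} p q → antisym x y (T⇒≡ p) (T⇒≡ q)
          }
        ; total = λ x y → Sum.map ≡⇒T ≡⇒T (total x y)
        }
      ; _≟_ = eq
      -- does (T? b) reduces to b, so List.merge _≤?_ takes the branches of merge le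
      ; _≤?_ = λ x y → T? (le x y)
      }
    }

  ≤-totalOrder : Bundles.TotalOrder 0ℓ 0ℓ 0ℓ
  ≤-totalOrder = DecTotalOrder.totalOrder ≤-decTotalOrder

  merge-sorted : ∀ {xs ys} → Sorted ≤-totalOrder xs → Sorted ≤-totalOrder ys →
    Sorted ≤-totalOrder (merge le xs ys)
  merge-sorted {xs} {ys} sxs sys =
    subst (Sorted ≤-totalOrder) (≡.sym (merge≡List-merge le xs ys)) (merge⁺ ≤-decTotalOrder sxs sys)

  sorted-↭⇒≡ : ∀ {xs ys} → Sorted ≤-totalOrder xs → Sorted ≤-totalOrder ys → xs ↭ ys → xs ≡ ys
  sorted-↭⇒≡ sxs sys p = Pointwise-≡⇒≡ (↗↭↗⇒≋ ≤-totalOrder sxs sys (↭⇒↭ₛ p))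

reverse-sorted : {A : Set} (eq : DecidableEquality A) {le : A → A → Bool} (order : TotalOrder le) →
  ∀ {xs} → Sorted (≤-totalOrder eq order) xs → Sorted (≤-totalOrder eq (converse-TotalOrder order)) (reverse xs)
reverse-sorted eq order s = AllPairs⇒Sorted (≤-totalOrder eq (converse-TotalOrder order))
  (AllPairs-reverse (Sorted⇒AllPairs (≤-totalOrder eq order) s))

revmerge-sorted : {A : Set} (eq : DecidableEquality A) {le : A → A → Bool} (order : TotalOrder le) →
  ∀ {xs ys} → Sorted (≤-totalOrder eq order) xs → Sorted (≤-totalOrder eq order) ys →
  Sorted (≤-totalOrder eq order) (revmerge le xs ys)
revmerge-sorted eq order sxs sys = reverse-sorted eq (converse-TotalOrder order)
  (merge-sorted eq (converse-TotalOrder order) (reverse-sorted eq order sys) (reverse-sorted eq order sxs))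

asort-related : {asort : ASortType} → Parametric asort →
  (A R₁ R₂ : Set) (le : A → A → Bool) (_∼_ : R₁ → R₂ → Set) →
  (m₁ : R₁ → R₁ → R₁) (m₂ : R₂ → R₂ → R₂) →
  (∀ {a₁ a₂ b₁ b₂} → a₁ ∼ a₂ → b₁ ∼ b₂ → m₁ a₁ b₁ ∼ m₂ a₂ b₂) →
  (m₁' : R₁ → R₁ → R₁) (m₂' : R₂ → R₂ → R₂) →
  (∀ {a₁ a₂ b₁ b₂} → a₁ ∼ a₂ → b₁ ∼ b₂ → m₁' a₁ b₁ ∼ m₂' a₂ b₂) →
  (s₁ : A → R₁) (s₂ : A → R₂) → (∀ x → s₁ x ∼ s₂ x) →
  (e₁ : R₁) (e₂ : R₂) → e₁ ∼ e₂ →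
  ∀ xs → asort A R₁ le m₁ m₁' s₁ e₁ xs ∼ asort A R₂ le m₂ m₂' s₂ e₂ xs
asort-related par A R₁ R₂ le _∼_ m₁ m₂ m∼ m₁' m₂' m'∼ s₁ s₂ s∼ e₁ e₂ e∼ xs =
  par A A _≡_ R₁ R₂ _∼_ le le (cong₂ le) m₁ m₂ m∼ m₁' m₂' m'∼ s₁ s₂ (λ { refl → s∼ _ })
    e₁ e₂ e∼ xs xs (Pointwise.refl refl)

asort-preserves : {asort : ASortType} → Parametric asort →
  (A R : Set) (le : A → A → Bool) (P : R → Set) →
  (m : R → R → R) → (∀ {a b} → P a → P b → P (m a b)) →
  (m' : R → R → R) → (∀ {a b} → P a → P b → P (m' a b)) →
  (s : A → R) → (∀ x → P (s x)) → (e : R) → P e →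
  ∀ xs → P (asort A R le m m' s e xs)
asort-preserves par A R le P m Pm m' Pm' s Ps e Pe =
  asort-related par A R ⊤ le (λ a _ → P a) m _ Pm m' _ Pm' s _ Ps e tt Pe

sort-↭ : (sort : SortFun) → ExtendedCharacteristic sort →
  (A : Set) (le : A → A → Bool) → ∀ xs → sort A le xs ↭ xs
sort-↭ sort (asort , sort≡ , id≡ , par) A le xs =
  subst₂ _↭_ (sort≡ A le xs) (id≡ A le xs)
    (asort-related par A (List A) (List A) le _↭_
      (merge le) _++_ (λ {a₁} {_} {b₁} p q → ↭-trans (merge-↭-++ le a₁ b₁) (++⁺ p q))
      (revmerge le) _++_ (λ {a₁} {_} {b₁} p q → ↭-trans (revmerge-↭-++ le a₁ b₁) (++⁺ p q))
      [_] [_] (λ _ → ↭-refl) [] [] ↭-refl xs)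

sort-sorted : (sort : SortFun) → ExtendedCharacteristic sort →
  {A : Set} (eq : DecidableEquality A) {le : A → A → Bool} (order : TotalOrder le) →
  ∀ xs → Sorted (≤-totalOrder eq order) (sort A le xs)
sort-sorted sort (asort , sort≡ , _ , par) {A} eq {le} order xs =
  subst (Sorted (≤-totalOrder eq order)) (sort≡ A le xs)
    (asort-preserves par A (List A) le (Sorted (≤-totalOrder eq order))
      (merge le) (merge-sorted eq order) (revmerge le) (revmerge-sorted eq order)
      [_] (λ _ → [-]) [] [] xs)

lemmaB18 : (sort : SortFun) → ExtendedCharacteristic sort →
    (T : Set) (eq : DecidableEquality T) (le : T → T → Bool) → TotalOrder le →
    (s₁ s₂ : List T) →
    ((sort T le s₁ ≡ sort T le s₂ → Perm eq s₁ s₂) × (Perm eq s₁ s₂ → sort T le s₁ ≡ sort T le s₂))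
lemmaB18 sort ext T eq le order s₁ s₂ = sound , complete
  where
  open PermutationReasoning

  sound : sort T le s₁ ≡ sort T le s₂ → Perm eq s₁ s₂
  sound sorts≡ = ↭⇒Perm eq (begin
    s₁            ↭⟨ sort-↭ sort ext T le s₁ ⟨
    sort T le s₁  ≡⟨ sorts≡ ⟩
    sort T le s₂  ↭⟨ sort-↭ sort ext T le s₂ ⟩
    s₂            ∎)

  complete : Perm eq s₁ s₂ → sort T le s₁ ≡ sort T le s₂
  complete s₁≈s₂ =
    sorted-↭⇒≡ eq order (sort-sorted sort ext eq order s₁) (sort-sorted sort ext eq order s₂) (begin
      sort T le s₁  ↭⟨ sort-↭ sort ext T le s₁ ⟩
      s₁            ↭⟨ Perm⇒↭ eq s₁ s₂ s₁≈s₂ ⟩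
      s₂            ↭⟨ sort-↭ sort ext T le s₂ ⟨
      sort T le s₂  ∎)
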